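{- There is no randomized algorithm for oracle-EMB that, for every oracle-EMB instance $I=(E,\mathcal{I},c,T)$, with $n=|E|+1$ and $m=c(E)+1$, runs in time $(n\cdot(T+2)\cdot m)^{O(1)}$.
   Context: A matroid is a pair $(E,\mathcal{I})$ with $E$ finite, $\emptyset\in\mathcal{I}\subseteq 2^E$, $\mathcal{I}$ closed under subsets, and the exchange property (for $A,B\in\mathcal{I}$ with $|A|>|B|$ there is $e\in A\setminus B$ with $B\cup\{e\}\in\mathcal{I}$). A basis is an independent set of maximum cardinality. For $c:E\to\mathbb{N}$ and $S\subseteq E$, $c(S)=\sum_{e\in S}c(e)$. Exact Matroid Basis (EMB): an instance is $(E,\mathcal{I},c,T)$ where $(E,\mathcal{I})$ is a matroid, $c:E\to\mathbb{N}$, $T\in\mathbb{N}$; the question is whether there is a basis $S$ of $(E,\mathcal{I})$ with $c(S)=T$. In oracle-EMB, $E,c,T$ are given explicitly and $\mathcal{I}$ is accessible only via a membership oracle (deciding whether a given $S\subseteq E$ is in $\mathcal{I}$ in one query); running time counts queries plus basic operations. A randomized algorithm for a decision problem returns "yes" with probability at least $1/2$ on every yes-instance and returns "no" with probability $1$ on every no-instance. -}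

module Defs where

open import Data.Nat using (ℕ; zero; suc; _+_; _*_; _^_; _≤_; _<_)
open import Data.Bool using (Bool; true; false)
open import Data.Fin using (Fin)
open import Data.Fin.Subset using (Subset; _∈_; _∉_; _⊆_; ∣_∣; ⊥; ⊤; _∪_; ⁅_⁆)
open import Data.Vec using (Vec; []; _∷_)
open import Data.List using (List; []; _∷_; _++_; map; length; filter)
open import Data.Product using (Σ; _×_; ∃; ∃-syntax)
open import Relation.Binary.PropositionalEquality using (_≡_)
open import Data.Bool.Properties using () renaming (_≟_ to _≟B_)

-- Ground set E = Fin k.  A family of subsets 𝓘 is given as its
-- membership oracle  Subset k → Bool  (S ∈ 𝓘  iff  𝓘 S ≡ true).
Indep : {k : ℕ} → (Subset k → Bool) → Subset k → Set
Indep 𝓘 S = 𝓘 S ≡ true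

record IsMatroid {k : ℕ} (𝓘 : Subset k → Bool) : Set where
  field
    empty-indep : Indep 𝓘 ⊥
    down-closed : ∀ (A B : Subset k) → B ⊆ A → Indep 𝓘 A → Indep 𝓘 B
    exchange    : ∀ (A B : Subset k) → Indep 𝓘 A → Indep 𝓘 B → ∣ B ∣ < ∣ A ∣ →
                  ∃[ e ] (e ∈ A × e ∉ B × Indep 𝓘 (B ∪ ⁅ e ⁆))

IsBasis : {k : ℕ} → (Subset k → Bool) → Subset k → Set
IsBasis {k} 𝓘 S = Indep 𝓘 S × (∀ (S' : Subset k) → Indep 𝓘 S' → ∣ S' ∣ ≤ ∣ S ∣)

weight : {k : ℕ} → (Fin k → ℕ) → Subset k → ℕ
weight {zero}  c []            = 0
weight {suc k} c (true  ∷ S)   = c Fin.zero + weight (λ i → c (Fin.suc i)) S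
weight {suc k} c (false ∷ S)   = weight (λ i → c (Fin.suc i)) S

EMBYes : (k : ℕ) → (Fin k → ℕ) → ℕ → (Subset k → Bool) → Set
EMBYes k c T 𝓘 = ∃[ S ] (IsBasis 𝓘 S × weight c S ≡ T)

-- Adaptive oracle query tree over ground set Fin k: each internal node
-- queries membership of a subset in 𝓘 and branches on the answer;
-- leaves give the output (true = "yes").
data QTree (k : ℕ) : Set where
  leaf  : Bool → QTree k
  query : Subset k → (Bool → QTree k) → QTree k

run : {k : ℕ} → QTree k → (Subset k → Bool) → Bool
run (leaf b)    𝓘 = b
run (query S f) 𝓘 = run (f (𝓘 S)) 𝓘

queries : {k : ℕ} → QTree k → (Subset k → Bool) → ℕ
queries (leaf b)    𝓘 = 0
queries (query S f) 𝓘 = suc (queries (f (𝓘 S)) 𝓘)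

-- A randomized oracle algorithm: on explicit input (E = Fin k, c, T) it
-- draws a uniformly random string of  bits k c T  bits, and each random
-- string determines an adaptive query strategy.
record RandAlg : Set where
  field
    bits : (k : ℕ) → (Fin k → ℕ) → ℕ → ℕ
    tree : (k : ℕ) (c : Fin k → ℕ) (T : ℕ) → Vec Bool (bits k c T) → QTree k

allStrings : (n : ℕ) → List (Vec Bool n)
allStrings zero    = [] ∷ []
allStrings (suc n) = map (true ∷_) (allStrings n) ++ map (false ∷_) (allStrings n)

acceptCount : (A : RandAlg) (k : ℕ) (c : Fin k → ℕ) (T : ℕ) → (Subset k → Bool) → ℕ
acceptCount A k c T 𝓘 =
  length (filter (λ r → run (RandAlg.tree A k c T r) 𝓘 ≟B true)
                 (allStrings (RandAlg.bits A k c T)))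

-- One-sided error correctness on one instance
Correct : (A : RandAlg) (k : ℕ) (c : Fin k → ℕ) (T : ℕ) → (Subset k → Bool) → Set
Correct A k c T 𝓘 =
  (EMBYes k c T 𝓘 → 2 ^ RandAlg.bits A k c T ≤ 2 * acceptCount A k c T 𝓘)
  × ((EMBYes k c T 𝓘 → Data.Empty.⊥) →
       ∀ (r : Vec Bool (RandAlg.bits A k c T)) → run (RandAlg.tree A k c T r) 𝓘 ≡ false)
  where import Data.Empty

-- Running time (oracle queries) ≤ (n·(T+2)·m)^d on every random string,
-- with n = |E|+1, m = c(E)+1.
TimeBound : (A : RandAlg) (d k : ℕ) (c : Fin k → ℕ) (T : ℕ) → (Subset k → Bool) → Set
TimeBound A d k c T 𝓘 =
  ∀ (r : Vec Bool (RandAlg.bits A k c T)) →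
    queries (RandAlg.tree A k c T r) 𝓘 ≤ ((suc k) * (T + 2) * suc (weight c ⊤)) ^ d

{-# OPTIONS --safe #-}
-- An adversary argument on sparse paving matroids. Take n blocks {4j, …, 4j+3} with cost c = toℕ. A string
-- v ∈ {0,1}ⁿ picks one of the pairs {4j, 4j+3}, {4j+1, 4j+2} in each block; both pairs cost 8j+3, so the
-- 2ⁿ sets encode v all have size h = 2n and the same weight T. Let N be the sparse paving matroid of rank h
-- in which every h-set of weight T is dependent, and M v the one in which encode v alone is exempted. Then N
-- is a no-instance, M v is a yes-instance, and the two oracles differ only at encode v, so whenever the
-- algorithm accepts M v on a random string, its run on N with that string queries encode v. Accepting every
-- M v on half of the 2ᵇ strings while making at most Q queries on N forces 2ⁿ · 2ᵇ ≤ 2 · 2ᵇ · Q. Since all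
-- parameters of the instances are polynomial in n, Q ≤ (8n)^(5d), which 2ⁿ outgrows.
module Submission where

open import Defs
open import Data.Nat using (ℕ; zero; suc; _+_; _*_; _^_; _≤_; _<_; z≤n; s≤s; z<s; _<?_; _≟_)
open import Data.Nat.Properties
open import Data.Nat.Tactic.RingSolver using (solve-∀)
open import Data.Bool using (Bool; true; false; if_then_else_)
open import Data.Bool.Properties using () renaming (_≟_ to _≟B_)
open import Data.Fin using (Fin; toℕ) renaming (zero to fzero; suc to fsuc)
open import Data.Fin.Properties using (toℕ-injective; toℕ<n)
open import Data.Fin.Subset using (Subset; _∈_; _∉_; _⊆_; ∣_∣; ⊥; ⊤; _∪_; ⁅_⁆; inside; outside)
open import Data.Fin.Subset.Properties
  using (drop-there; out⊆; in⊆in; p⊆q⇒∣p∣≤∣q∣; p⊂q⇒∣p∣<∣q∣; ⊆-antisym; ∪-identityʳ; x∈p∪q⁺; x∈⁅x⁆; ∣⊥∣≡0)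
open import Data.Vec using (Vec; []; _∷_; here; there; replicate)
open import Data.Vec.Properties using (≡-dec)
open import Data.List using (List; []; _∷_; _++_; map; length; filter)
open import Data.List.Properties using (length-++; length-map)
open import Data.List.Relation.Unary.Any as Any using (Any)
open import Data.Product using (_×_; _,_; proj₁; proj₂; ∃-syntax)
open import Data.Sum using (_⊎_; inj₁; inj₂)
open import Function using (_∘_; Injective; _⇔_; mk⇔; Equivalence)
open import Relation.Binary.PropositionalEquality
open import Relation.Nullary using (¬_; Dec; yes; no; does; contradiction)
open import Relation.Nullary.Decidable using (_⊎-dec_; _×-dec_; ¬?; dec-true; does-⇔; decidable-stable)
open import Relation.Unary using (Decidable)
open import Level using (Level)

_≟ᵥ_ : ∀ {n} (u v : Vec Bool n) → Dec (u ≡ v)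
_≟ᵥ_ = ≡-dec _≟B_

p⊆q⊎∃x∈p∉q : ∀ {k} (p q : Subset k) → p ⊆ q ⊎ ∃[ x ] (x ∈ p × x ∉ q)
p⊆q⊎∃x∈p∉q [] [] = inj₁ λ ()
p⊆q⊎∃x∈p∉q (s ∷ p) (t ∷ q) with p⊆q⊎∃x∈p∉q p q
... | inj₂ (x , x∈p , x∉q) = inj₂ (fsuc x , there x∈p , x∉q ∘ drop-there)
p⊆q⊎∃x∈p∉q (outside ∷ p) (t       ∷ q) | inj₁ p⊆q = inj₁ (out⊆ p⊆q)
p⊆q⊎∃x∈p∉q (inside  ∷ p) (inside  ∷ q) | inj₁ p⊆q = inj₁ (in⊆in p⊆q)
p⊆q⊎∃x∈p∉q (inside  ∷ p) (outside ∷ q) | inj₁ _   = inj₂ (fzero , here , λ ())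

∣q∣<∣p∣⇒∃x∈p∉q : ∀ {k} {p q : Subset k} → ∣ q ∣ < ∣ p ∣ → ∃[ x ] (x ∈ p × x ∉ q)
∣q∣<∣p∣⇒∃x∈p∉q {p = p} {q} ∣q∣<∣p∣ with p⊆q⊎∃x∈p∉q p q
... | inj₁ p⊆q = contradiction (p⊆q⇒∣p∣≤∣q∣ p⊆q) (<⇒≱ ∣q∣<∣p∣)
... | inj₂ x∈p∖q = x∈p∖q

p⊆q∧∣q∣≤∣p∣⇒p≡q : ∀ {k} {p q : Subset k} → p ⊆ q → ∣ q ∣ ≤ ∣ p ∣ → p ≡ q
p⊆q∧∣q∣≤∣p∣⇒p≡q {p = p} {q} p⊆q ∣q∣≤∣p∣ with p⊆q⊎∃x∈p∉q q p
... | inj₁ q⊆p = ⊆-antisym p⊆q q⊆p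
... | inj₂ (x , x∈q , x∉p) = contradiction (p⊂q⇒∣p∣<∣q∣ (p⊆q , x , x∈q , x∉p)) (≤⇒≯ ∣q∣≤∣p∣)

∣p∪⁅x⁆∣≡1+∣p∣ : ∀ {k} (p : Subset k) {x} → x ∉ p → ∣ p ∪ ⁅ x ⁆ ∣ ≡ suc ∣ p ∣
∣p∪⁅x⁆∣≡1+∣p∣ (inside  ∷ p) {fzero}  x∉p = contradiction here x∉p
∣p∪⁅x⁆∣≡1+∣p∣ (outside ∷ p) {fzero}  _   = cong (suc ∘ ∣_∣) (∪-identityʳ p)
∣p∪⁅x⁆∣≡1+∣p∣ (inside  ∷ p) {fsuc x} x∉p = cong suc (∣p∪⁅x⁆∣≡1+∣p∣ p (x∉p ∘ there))
∣p∪⁅x⁆∣≡1+∣p∣ (outside ∷ p) {fsuc x} x∉p = ∣p∪⁅x⁆∣≡1+∣p∣ p (x∉p ∘ there)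

weight-cong : ∀ {k} {c c′ : Fin k → ℕ} → (∀ i → c i ≡ c′ i) → ∀ S → weight c S ≡ weight c′ S
weight-cong {zero}  c≗c′ []            = refl
weight-cong {suc k} c≗c′ (inside  ∷ S) = cong₂ _+_ (c≗c′ fzero) (weight-cong (c≗c′ ∘ fsuc) S)
weight-cong {suc k} c≗c′ (outside ∷ S) = weight-cong (c≗c′ ∘ fsuc) S

weight-∪⁅x⁆ : ∀ {k} (c : Fin k → ℕ) (S : Subset k) {x} → x ∉ S → weight c (S ∪ ⁅ x ⁆) ≡ c x + weight c S
weight-∪⁅x⁆ c (inside  ∷ S) {fzero}  x∉S = contradiction here x∉S
weight-∪⁅x⁆ c (outside ∷ S) {fzero}  _   = cong (λ S′ → c fzero + weight (c ∘ fsuc) S′) (∪-identityʳ S)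
weight-∪⁅x⁆ c (inside  ∷ S) {fsuc x} x∉S = begin
  c fzero + weight (c ∘ fsuc) (S ∪ ⁅ x ⁆)     ≡⟨ cong (c fzero +_) (weight-∪⁅x⁆ (c ∘ fsuc) S (x∉S ∘ there)) ⟩
  c fzero + (c (fsuc x) + weight (c ∘ fsuc) S) ≡⟨ +-comm-middle (c fzero) (c (fsuc x)) _ ⟩
  c (fsuc x) + (c fzero + weight (c ∘ fsuc) S) ∎
  where
  open ≡-Reasoning
  +-comm-middle : ∀ a b w → a + (b + w) ≡ b + (a + w)
  +-comm-middle = solve-∀
weight-∪⁅x⁆ c (outside ∷ S) {fsuc x} x∉S = weight-∪⁅x⁆ (c ∘ fsuc) S (x∉S ∘ there)

weight≤weight⊤ : ∀ {k} (c : Fin k → ℕ) S → weight c S ≤ weight c ⊤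
weight≤weight⊤ {zero}  c []            = z≤n
weight≤weight⊤ {suc k} c (inside  ∷ S) = +-monoʳ-≤ (c fzero) (weight≤weight⊤ (c ∘ fsuc) S)
weight≤weight⊤ {suc k} c (outside ∷ S) = ≤-trans (weight≤weight⊤ (c ∘ fsuc) S) (m≤n+m _ (c fzero))

weight⊤≤k*max : ∀ {k} (c : Fin k → ℕ) {M} → (∀ i → c i ≤ M) → weight c ⊤ ≤ k * M
weight⊤≤k*max {zero}  c c≤M = z≤n
weight⊤≤k*max {suc k} c c≤M = +-mono-≤ (c≤M fzero) (weight⊤≤k*max (c ∘ fsuc) (c≤M ∘ fsuc))

-- Sparse paving matroids

-- For Sparse Bad this is the sparse paving matroid of rank h whose circuit-hyperplanes are the bad h-sets.
Paving : ∀ {k} → ℕ → (Subset k → Set) → Subset k → Set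
Paving h Bad S = ∣ S ∣ < h ⊎ (∣ S ∣ ≡ h × ¬ Bad S)

Sparse : ∀ {k} → (Subset k → Set) → Set
Sparse Bad = ∀ S {x y} → x ∉ S → y ∉ S → Bad (S ∪ ⁅ x ⁆) → Bad (S ∪ ⁅ y ⁆) → x ≡ y

Sparse-anti : ∀ {k} {Bad Bad′ : Subset k → Set} → (∀ {S} → Bad′ S → Bad S) → Sparse Bad → Sparse Bad′
Sparse-anti Bad′⊆Bad sparse S x∉S y∉S bx by = sparse S x∉S y∉S (Bad′⊆Bad bx) (Bad′⊆Bad by)

paving? : ∀ {k} h {Bad : Subset k → Set} → Decidable Bad → Decidable (Paving h Bad)
paving? h bad? S = (∣ S ∣ <? h) ⊎-dec ((∣ S ∣ ≟ h) ×-dec ¬? (bad? S))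

pavingOracle : ∀ {k} h {Bad : Subset k → Set} → Decidable Bad → Subset k → Bool
pavingOracle h bad? S = does (paving? h bad? S)

pavingOracle-cong : ∀ {k} h {Bad Bad′ : Subset k → Set} (bad? : Decidable Bad) (bad′? : Decidable Bad′) {S} →
                    Bad S ⇔ Bad′ S → pavingOracle h bad? S ≡ pavingOracle h bad′? S
pavingOracle-cong h bad? bad′? {S} Bad⇔Bad′ = does-⇔ (mk⇔ (map-good from) (map-good to)) (paving? h bad? S) (paving? h bad′? S)
  where
  open Equivalence Bad⇔Bad′
  map-good : ∀ {B B′ : Set} → (B′ → B) → ∣ S ∣ < h ⊎ (∣ S ∣ ≡ h × ¬ B) → ∣ S ∣ < h ⊎ (∣ S ∣ ≡ h × ¬ B′)
  map-good B′→B (inj₁ small)        = inj₁ small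
  map-good B′→B (inj₂ (full , ¬b)) = inj₂ (full , ¬b ∘ B′→B)

does≡true⇒ : ∀ {P : Set} (P? : Dec P) → does P? ≡ true → P
does≡true⇒ (yes p) _  = p
does≡true⇒ (no _)  ()

module PavingMatroid {k h : ℕ} {Bad : Subset k → Set} (bad? : Decidable Bad) where

  oracle : Subset k → Bool
  oracle = pavingOracle h bad?

  indep⇒paving : ∀ {S} → Indep oracle S → Paving h Bad S
  indep⇒paving {S} = does≡true⇒ (paving? h bad? S)

  paving⇒indep : ∀ {S} → Paving h Bad S → Indep oracle S
  paving⇒indep {S} = dec-true (paving? h bad? S)

  paving⇒∣S∣≤h : ∀ {S} → Paving h Bad S → ∣ S ∣ ≤ h
  paving⇒∣S∣≤h (inj₁ small)      = <⇒≤ small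
  paving⇒∣S∣≤h (inj₂ (full , _)) = ≤-reflexive full

  paving-downClosed : ∀ {A B} → B ⊆ A → Paving h Bad A → Paving h Bad B
  paving-downClosed {A} {B} B⊆A pA with ∣ B ∣ <? h
  ... | yes small = inj₁ small
  ... | no ¬small = subst (Paving h Bad) (sym B≡A) pA
    where
    B≡A : B ≡ A
    B≡A = p⊆q∧∣q∣≤∣p∣⇒p≡q B⊆A (≤-trans (paving⇒∣S∣≤h pA) (≮⇒≥ ¬small))

  exchange-reaching-rank : Sparse Bad → ∀ {A B x} → Paving h Bad A → h ≤ ∣ A ∣ → suc ∣ B ∣ ≡ h →
                  x ∈ A → x ∉ B → ∃[ y ] (y ∈ A × y ∉ B × Paving h Bad (B ∪ ⁅ y ⁆))
  exchange-reaching-rank sparse {A} {B} {x} pA h≤∣A∣ full x∈A x∉B with bad? (B ∪ ⁅ x ⁆) | pA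
  ... | no ¬badBx | _ = x , x∈A , x∉B , inj₂ (trans (∣p∪⁅x⁆∣≡1+∣p∣ B x∉B) full , ¬badBx)
  ... | yes _     | inj₁ small = contradiction h≤∣A∣ (<⇒≱ small)
  ... | yes badBx | inj₂ (_ , ¬badA) with p⊆q⊎∃x∈p∉q A (B ∪ ⁅ x ⁆)
  ...   | inj₁ A⊆Bx = contradiction (subst Bad (sym A≡Bx) badBx) ¬badA
    where
    A≡Bx : A ≡ B ∪ ⁅ x ⁆
    A≡Bx = p⊆q∧∣q∣≤∣p∣⇒p≡q A⊆Bx (≤-trans (≤-reflexive (trans (∣p∪⁅x⁆∣≡1+∣p∣ B x∉B) full)) h≤∣A∣)
  ...   | inj₂ (y , y∈A , y∉Bx) =
    y , y∈A , y∉B , inj₂ (trans (∣p∪⁅x⁆∣≡1+∣p∣ B y∉B) full , λ badBy → y≢x (sparse B y∉B x∉B badBy badBx))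
    where
    y∉B : y ∉ B
    y∉B = y∉Bx ∘ x∈p∪q⁺ ∘ inj₁
    y≢x : y ≢ x
    y≢x refl = y∉Bx (x∈p∪q⁺ (inj₂ (x∈⁅x⁆ x)))

  paving-exchange : Sparse Bad → ∀ {A B} → Paving h Bad A → ∣ B ∣ < ∣ A ∣ →
                    ∃[ x ] (x ∈ A × x ∉ B × Paving h Bad (B ∪ ⁅ x ⁆))
  paving-exchange sparse {B = B} pA ∣B∣<∣A∣ with ∣q∣<∣p∣⇒∃x∈p∉q ∣B∣<∣A∣
  ... | x , x∈A , x∉B with suc ∣ B ∣ <? h
  ...   | yes room = x , x∈A , x∉B , inj₁ (subst (_< h) (sym (∣p∪⁅x⁆∣≡1+∣p∣ B x∉B)) room)
  ...   | no ¬room = exchange-reaching-rank sparse pA (≤-trans (≮⇒≥ ¬room) ∣B∣<∣A∣)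
                       (≤-antisym (≤-trans ∣B∣<∣A∣ (paving⇒∣S∣≤h pA)) (≮⇒≥ ¬room)) x∈A x∉B

  isMatroid : 0 < h → Sparse Bad → IsMatroid oracle
  isMatroid 0<h sparse = record
    { empty-indep = paving⇒indep (inj₁ (subst (_< h) (sym (∣⊥∣≡0 k)) 0<h))
    ; down-closed = λ A B B⊆A → paving⇒indep ∘ paving-downClosed B⊆A ∘ indep⇒paving
    ; exchange    = λ A B iA _ ∣B∣<∣A∣ →
        let x , x∈A , x∉B , pBx = paving-exchange sparse (indep⇒paving iA) ∣B∣<∣A∣
        in x , x∈A , x∉B , paving⇒indep pBx
    }

  good⇒basis : ∀ {S} → ∣ S ∣ ≡ h → ¬ Bad S → IsBasis oracle S
  good⇒basis {S} full ¬bad =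
    paving⇒indep (inj₂ (full , ¬bad)) ,
    λ S′ iS′ → subst (∣ S′ ∣ ≤_) (sym full) (paving⇒∣S∣≤h (indep⇒paving iS′))

  basis⇒good : ∀ {S₀ S} → ∣ S₀ ∣ ≡ h → ¬ Bad S₀ → IsBasis oracle S → ¬ Bad S
  basis⇒good {S₀} {S} full₀ ¬bad₀ (iS , maximal) with indep⇒paving iS
  ... | inj₁ small = contradiction (subst (_≤ ∣ S ∣) full₀ (maximal S₀ (paving⇒indep (inj₂ (full₀ , ¬bad₀))))) (<⇒≱ small)
  ... | inj₂ (_ , ¬bad) = ¬bad

weight≡-sparse : ∀ {k} {c : Fin k → ℕ} → Injective _≡_ _≡_ c → ∀ T → Sparse (λ S → weight c S ≡ T)
weight≡-sparse {c = c} c-injective T S {x} {y} x∉S y∉S wx≡T wy≡T = c-injective (+-cancelʳ-≡ (weight c S) (c x) (c y) (begin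
  c x + weight c S     ≡⟨ weight-∪⁅x⁆ c S x∉S ⟨
  weight c (S ∪ ⁅ x ⁆) ≡⟨ trans wx≡T (sym wy≡T) ⟩
  weight c (S ∪ ⁅ y ⁆) ≡⟨ weight-∪⁅x⁆ c S y∉S ⟩
  c y + weight c S     ∎))
  where open ≡-Reasoning

private variable
  ℓ ℓ′ : Level
  A : Set ℓ
  B : Set ℓ′

∑ : List A → (A → ℕ) → ℕ
∑ []       f = 0
∑ (x ∷ xs) f = f x + ∑ xs f

infix 5 ∑
syntax ∑ L (λ x → e) = ∑[ x ∈ L ] e

∑-mono-≤ : ∀ (L : List A) {f g : A → ℕ} → (∀ x → f x ≤ g x) → ∑ L f ≤ ∑ L g
∑-mono-≤ []      f≤g = z≤n
∑-mono-≤ (x ∷ L) f≤g = +-mono-≤ (f≤g x) (∑-mono-≤ L f≤g)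

∑-cong : ∀ (L : List A) {f g : A → ℕ} → (∀ x → f x ≡ g x) → ∑ L f ≡ ∑ L g
∑-cong []      f≗g = refl
∑-cong (x ∷ L) f≗g = cong₂ _+_ (f≗g x) (∑-cong L f≗g)

∑-zero : ∀ (L : List A) → ∑[ _ ∈ L ] 0 ≡ 0
∑-zero []      = refl
∑-zero (x ∷ L) = ∑-zero L

∑-const : ∀ (L : List A) c → ∑[ _ ∈ L ] c ≡ length L * c
∑-const []      c = refl
∑-const (x ∷ L) c = cong (c +_) (∑-const L c)

∑-*-distribˡ : ∀ (L : List A) m (f : A → ℕ) → ∑[ x ∈ L ] (m * f x) ≡ m * ∑ L f
∑-*-distribˡ []      m f = sym (*-zeroʳ m)
∑-*-distribˡ (x ∷ L) m f = trans (cong (m * f x +_) (∑-*-distribˡ L m f)) (sym (*-distribˡ-+ m (f x) (∑ L f)))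

∑-+ : ∀ (L : List A) (f g : A → ℕ) → ∑[ x ∈ L ] (f x + g x) ≡ ∑ L f + ∑ L g
∑-+ []      f g = refl
∑-+ (x ∷ L) f g = trans (cong (f x + g x +_) (∑-+ L f g)) (+-interchange (f x) (g x) (∑ L f) (∑ L g))
  where
  +-interchange : ∀ a b c d → (a + b) + (c + d) ≡ (a + c) + (b + d)
  +-interchange = solve-∀

∑-++ : ∀ (L L′ : List A) (f : A → ℕ) → ∑ (L ++ L′) f ≡ ∑ L f + ∑ L′ f
∑-++ []      L′ f = refl
∑-++ (x ∷ L) L′ f = trans (cong (f x +_) (∑-++ L L′ f)) (sym (+-assoc (f x) _ _))

∑-map : ∀ (g : A → B) (L : List A) (f : B → ℕ) → ∑ (map g L) f ≡ ∑[ x ∈ L ] f (g x)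
∑-map g []      f = refl
∑-map g (x ∷ L) f = cong (f (g x) +_) (∑-map g L f)

∑-comm : ∀ (L : List A) (L′ : List B) (F : A → B → ℕ) →
         ∑[ x ∈ L ] ∑[ y ∈ L′ ] F x y ≡ ∑[ y ∈ L′ ] ∑[ x ∈ L ] F x y
∑-comm []      L′ F = sym (∑-zero L′)
∑-comm (x ∷ L) L′ F = trans (cong ((∑[ y ∈ L′ ] F x y) +_) (∑-comm L L′ F)) (sym (∑-+ L′ (F x) _))

Any⇒≤∑ : ∀ {L : List A} {f : A → ℕ} {m} → Any (λ x → m ≤ f x) L → m ≤ ∑ L f
Any⇒≤∑ {L = x ∷ L} {f} (Any.here m≤fx) = ≤-trans m≤fx (m≤m+n (f x) (∑ L f))
Any⇒≤∑ {L = x ∷ L} {f} (Any.there m≤∑) = ≤-trans (Any⇒≤∑ m≤∑) (m≤n+m (∑ L f) (f x))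

length-filter≤∑ : ∀ {P : A → Set} (P? : Decidable P) (L : List A) {f : A → ℕ} →
                  (∀ x → P x → 1 ≤ f x) → length (filter P? L) ≤ ∑ L f
length-filter≤∑ P? []      P⇒1≤f = z≤n
length-filter≤∑ P? (x ∷ L) {f} P⇒1≤f with P? x
... | yes Px = +-mono-≤ (P⇒1≤f x Px) (length-filter≤∑ P? L P⇒1≤f)
... | no _   = ≤-trans (length-filter≤∑ P? L P⇒1≤f) (m≤n+m (∑ L f) (f x))

𝟙 : ∀ {P : Set} → Dec P → ℕ
𝟙 P? = if does P? then 1 else 0

𝟙-yes : ∀ {P : Set} (P? : Dec P) → P → 𝟙 P? ≡ 1
𝟙-yes P? p = cong (λ b → if b then 1 else 0) (dec-true P? p)

length-allStrings : ∀ n → length (allStrings n) ≡ 2 ^ n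
length-allStrings zero    = refl
length-allStrings (suc n) = begin
  length (map (true ∷_) (allStrings n) ++ map (false ∷_) (allStrings n))
    ≡⟨ length-++ (map (true ∷_) (allStrings n)) ⟩
  length (map (true ∷_) (allStrings n)) + length (map (false ∷_) (allStrings n))
    ≡⟨ cong₂ _+_ (length-map (true ∷_) (allStrings n)) (length-map (false ∷_) (allStrings n)) ⟩
  length (allStrings n) + length (allStrings n)
    ≡⟨ cong₂ _+_ (length-allStrings n) (trans (length-allStrings n) (sym (+-identityʳ (2 ^ n)))) ⟩
  2 ^ suc n ∎
  where open ≡-Reasoning

∑-allStrings : ∀ n (f : Vec Bool (suc n) → ℕ) →
               ∑ (allStrings (suc n)) f ≡ (∑[ v ∈ allStrings n ] f (true ∷ v)) + (∑[ v ∈ allStrings n ] f (false ∷ v))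
∑-allStrings n f = trans (∑-++ (map (true ∷_) (allStrings n)) _ f)
                         (cong₂ _+_ (∑-map (true ∷_) (allStrings n) f) (∑-map (false ∷_) (allStrings n) f))

allStrings-∑𝟙≡ : ∀ {n} (u : Vec Bool n) → ∑[ v ∈ allStrings n ] 𝟙 (u ≟ᵥ v) ≡ 1
allStrings-∑𝟙≡ []             = refl
allStrings-∑𝟙≡ {suc n} (true  ∷ u) = begin
  ∑[ v ∈ allStrings (suc n) ] 𝟙 ((true ∷ u) ≟ᵥ v) ≡⟨ ∑-allStrings n _ ⟩
  (∑[ v ∈ allStrings n ] 𝟙 (u ≟ᵥ v)) + (∑[ _ ∈ allStrings n ] 0) ≡⟨ cong₂ _+_ (allStrings-∑𝟙≡ u) (∑-zero (allStrings n)) ⟩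
  1 ∎
  where open ≡-Reasoning
allStrings-∑𝟙≡ {suc n} (false ∷ u) = begin
  ∑[ v ∈ allStrings (suc n) ] 𝟙 ((false ∷ u) ≟ᵥ v) ≡⟨ ∑-allStrings n _ ⟩
  (∑[ _ ∈ allStrings n ] 0) + (∑[ v ∈ allStrings n ] 𝟙 (u ≟ᵥ v)) ≡⟨ cong₂ _+_ (∑-zero (allStrings n)) (allStrings-∑𝟙≡ u) ⟩
  1 ∎
  where open ≡-Reasoning

∑-count-allStrings≡length : ∀ {n} (f : A → Vec Bool n) (L : List A) →
                     ∑[ v ∈ allStrings n ] ∑[ x ∈ L ] 𝟙 (f x ≟ᵥ v) ≡ length L
∑-count-allStrings≡length {n = n} f L = begin
  ∑[ v ∈ allStrings n ] ∑[ x ∈ L ] 𝟙 (f x ≟ᵥ v) ≡⟨ ∑-comm (allStrings n) L _ ⟩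
  ∑[ x ∈ L ] ∑[ v ∈ allStrings n ] 𝟙 (f x ≟ᵥ v) ≡⟨ ∑-cong L (allStrings-∑𝟙≡ ∘ f) ⟩
  ∑[ _ ∈ L ] 1                                 ≡⟨ trans (∑-const L 1) (*-identityʳ (length L)) ⟩
  length L ∎
  where open ≡-Reasoning

-- Query trees and the adversary argument

queried : ∀ {k} → QTree k → (Subset k → Bool) → List (Subset k)
queried (leaf _)    𝓘 = []
queried (query S f) 𝓘 = S ∷ queried (f (𝓘 S)) 𝓘

length-queried : ∀ {k} (t : QTree k) 𝓘 → length (queried t 𝓘) ≡ queries t 𝓘
length-queried (leaf _)    𝓘 = refl
length-queried (query S f) 𝓘 = cong suc (length-queried (f (𝓘 S)) 𝓘)

run-≢⇒queried-≢ : ∀ {k} (t : QTree k) {𝓘 𝓙} → run t 𝓘 ≢ run t 𝓙 → Any (λ S → 𝓘 S ≢ 𝓙 S) (queried t 𝓘)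
run-≢⇒queried-≢ (leaf _)    run≢ = contradiction refl run≢
run-≢⇒queried-≢ (query S f) {𝓘} {𝓙} run≢ with 𝓘 S ≟B 𝓙 S
... | no 𝓘S≢𝓙S  = Any.here 𝓘S≢𝓙S
... | yes 𝓘S≡𝓙S = Any.there (run-≢⇒queried-≢ (f (𝓘 S)) (run≢ ∘ λ eq → trans eq (cong (λ a → run (f a) 𝓙) 𝓘S≡𝓙S)))

adversary-bound :
  ∀ (A : RandAlg) {k} (c : Fin k → ℕ) T {n} (N : Subset k → Bool) (M : Vec Bool n → Subset k → Bool)
    (encode : Vec Bool n → Subset k) (decode : Subset k → Vec Bool n) {Q} →
  (∀ v → decode (encode v) ≡ v) →
  (∀ v S → N S ≢ M v S → S ≡ encode v) →
  (∀ r → run (RandAlg.tree A k c T r) N ≡ false) →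
  (∀ r → queries (RandAlg.tree A k c T r) N ≤ Q) →
  (∀ v → 2 ^ RandAlg.bits A k c T ≤ 2 * acceptCount A k c T (M v)) →
  2 ^ n ≤ 2 * Q
adversary-bound A {k} c T {n} N M encode decode {Q} decode-encode differ⇒encode rejects-N fast-on-N accepts-M =
  *-cancelʳ-≤ (2 ^ n) (2 * Q) (2 ^ b) {{m^n≢0 2 b}} (begin
    2 ^ n * 2 ^ b                                ≡⟨ cong (_* 2 ^ b) (length-allStrings n) ⟨
    length V * 2 ^ b                             ≡⟨ ∑-const V (2 ^ b) ⟨
    ∑[ v ∈ V ] 2 ^ b                             ≤⟨ ∑-mono-≤ V accepts-M ⟩
    ∑[ v ∈ V ] 2 * acceptCount A k c T (M v)     ≡⟨ ∑-*-distribˡ V 2 _ ⟩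
    2 * (∑[ v ∈ V ] acceptCount A k c T (M v))   ≤⟨ *-monoʳ-≤ 2 (∑-mono-≤ V accepts≤hits) ⟩
    2 * (∑[ v ∈ V ] ∑[ r ∈ R ] hits v r)         ≡⟨ cong (2 *_) (∑-comm V R hits) ⟩
    2 * (∑[ r ∈ R ] ∑[ v ∈ V ] hits v r)         ≡⟨ cong (2 *_) (∑-cong R λ r → ∑-count-allStrings≡length decode (queried (alg r) N)) ⟩
    2 * (∑[ r ∈ R ] length (queried (alg r) N))  ≤⟨ *-monoʳ-≤ 2 (∑-mono-≤ R λ r → ≤-trans (≤-reflexive (length-queried (alg r) N)) (fast-on-N r)) ⟩
    2 * (∑[ _ ∈ R ] Q)                           ≡⟨ cong (2 *_) (trans (∑-const R Q) (cong (_* Q) (length-allStrings b))) ⟩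
    2 * (2 ^ b * Q)                              ≡⟨ reassoc 2 (2 ^ b) Q ⟩
    2 * Q * 2 ^ b                                ∎)
  where
  open ≤-Reasoning
  b : ℕ
  b = RandAlg.bits A k c T
  alg : Vec Bool b → QTree k
  alg = RandAlg.tree A k c T
  R : List (Vec Bool b)
  R = allStrings b
  V : List (Vec Bool n)
  V = allStrings n

  hits : Vec Bool n → Vec Bool b → ℕ
  hits v r = ∑[ S ∈ queried (alg r) N ] 𝟙 (decode S ≟ᵥ v)

  accept⇒hit : ∀ v r → run (alg r) (M v) ≡ true → 1 ≤ hits v r
  accept⇒hit v r accepts = Any⇒≤∑ (Any.map counted (run-≢⇒queried-≢ (alg r) run≢))
    where
    run≢ : run (alg r) N ≢ run (alg r) (M v)
    run≢ eq = contradiction (trans (sym (rejects-N r)) (trans eq accepts)) λ ()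
    counted : ∀ {S} → N S ≢ M v S → 1 ≤ 𝟙 (decode S ≟ᵥ v)
    counted {S} NS≢MS = ≤-reflexive (sym (𝟙-yes (decode S ≟ᵥ v) (trans (cong decode (differ⇒encode v S NS≢MS)) (decode-encode v))))

  accepts≤hits : ∀ v → acceptCount A k c T (M v) ≤ ∑[ r ∈ R ] hits v r
  accepts≤hits v = length-filter≤∑ (λ r → run (alg r) (M v) ≟B true) R (accept⇒hit v)

  reassoc : ∀ x y z → x * (y * z) ≡ x * z * y
  reassoc = solve-∀

instance-size≤ : ∀ m {T w} → T ≤ w → w ≤ (suc m * 4) * (suc m * 4) →
                 suc (suc m * 4) * (T + 2) * suc w ≤ (8 * suc m) ^ 5
instance-size≤ m {T} {w} T≤w w≤k² = begin
  suc k * (T + 2) * suc w ≤⟨ *-mono-≤ (*-mono-≤ 1+k≤K T+2≤K²) 1+w≤K² ⟩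
  K * (K * K) * (K * K)   ≡⟨ fifth-power K ⟩
  K ^ 5                   ∎
  where
  open ≤-Reasoning
  K-split : ∀ m → suc (suc m * 4) + (3 + m * 4) ≡ 8 * suc m
  K-split = solve-∀
  K²-split : ∀ m → (suc m * 4) * (suc m * 4) + 2 + (48 * m * m + 96 * m + 46) ≡ (8 * suc m) * (8 * suc m)
  K²-split = solve-∀
  fifth-power : ∀ x → x * (x * x) * (x * x) ≡ x * (x * (x * (x * (x * 1))))
  fifth-power = solve-∀
  k K : ℕ
  k = suc m * 4
  K = 8 * suc m
  1+k≤K : suc k ≤ K
  1+k≤K = ≤-trans (m≤m+n (suc k) (3 + m * 4)) (≤-reflexive (K-split m))
  k²+2≤K² : k * k + 2 ≤ K * K
  k²+2≤K² = ≤-trans (m≤m+n (k * k + 2) _) (≤-reflexive (K²-split m))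
  T+2≤K² : T + 2 ≤ K * K
  T+2≤K² = ≤-trans (+-monoˡ-≤ 2 (≤-trans T≤w w≤k²)) k²+2≤K²
  1+w≤K² : suc w ≤ K * K
  1+w≤K² = ≤-trans (n≤1+n (suc w)) (≤-trans (≤-reflexive (+-comm 2 w)) (≤-trans (+-monoˡ-≤ 2 w≤k²) k²+2≤K²))

n<2^n : ∀ n → n < 2 ^ n
n<2^n zero    = z<s
n<2^n (suc n) = +-mono-≤ (m^n>0 2 n) (≤-trans (n<2^n n) (≤-reflexive (sym (+-identityʳ (2 ^ n)))))

linear<2^ : ∀ a b → ∃[ t ] a * t + b < 2 ^ t
linear<2^ a b = s + s , (begin-strict
  a * (s + s) + b    <⟨ <-≤-trans (m<m+n _ z<s) (≤-reflexive (square-split a b)) ⟩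
  suc s * suc s      ≤⟨ *-mono-≤ (n<2^n s) (n<2^n s) ⟩
  2 ^ s * 2 ^ s      ≡⟨ ^-distribˡ-+-* 2 s s ⟨
  2 ^ (s + s)        ∎)
  where
  open ≤-Reasoning
  s : ℕ
  s = suc (a + a + b)
  square-split : ∀ a b → a * (suc (a + a + b) + suc (a + a + b)) + b + suc (b * (a + a + b) + 3 * suc (a + a + b))
                          ≡ suc (suc (a + a + b)) * suc (suc (a + a + b))
  square-split = solve-∀

2^-beats-poly : ∀ e → ∃[ m ] 2 * (8 * suc m) ^ e < 2 ^ suc m
2^-beats-poly e with linear<2^ e (4 * e)
... | t , et+4e<2^t = 2 ^ t , (begin-strict
  2 * (8 * suc (2 ^ t)) ^ e  ≤⟨ *-monoʳ-≤ 2 (^-monoˡ-≤ e 8+8x≤16x) ⟩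
  2 * (2 ^ (4 + t)) ^ e      ≡⟨ cong (2 *_) (^-*-assoc 2 (4 + t) e) ⟩
  2 ^ suc ((4 + t) * e)      <⟨ ^-monoʳ-< 2 (s≤s (s≤s z≤n)) (s≤s (subst (_< 2 ^ t) (sym (linear-form t e)) et+4e<2^t)) ⟩
  2 ^ suc (2 ^ t)            ∎)
  where
  open ≤-Reasoning
  8+8x≤16x : 8 * suc (2 ^ t) ≤ 2 ^ (4 + t)
  8+8x≤16x = begin
    8 * suc (2 ^ t)        ≡⟨ *-suc 8 (2 ^ t) ⟩
    8 + 8 * 2 ^ t          ≤⟨ +-monoˡ-≤ (8 * 2 ^ t) (*-monoʳ-≤ 8 (m^n>0 2 t)) ⟩
    8 * 2 ^ t + 8 * 2 ^ t  ≡⟨ doubling (2 ^ t) ⟩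
    2 ^ (4 + t)            ∎
    where
    doubling : ∀ x → 8 * x + 8 * x ≡ 2 * (2 * (2 * (2 * x)))
    doubling = solve-∀
  linear-form : ∀ t e → (4 + t) * e ≡ e * t + 4 * e
  linear-form = solve-∀

-- The hard instances

encode : ∀ {n} → Vec Bool n → Subset (n * 4)
encode []          = []
encode (true  ∷ v) = inside  ∷ outside ∷ outside ∷ inside  ∷ encode v
encode (false ∷ v) = outside ∷ inside  ∷ inside  ∷ outside ∷ encode v

decode : ∀ {n} → Subset (n * 4) → Vec Bool n
decode {zero}  []                  = []
decode {suc n} (a ∷ _ ∷ _ ∷ _ ∷ S) = a ∷ decode S

decode-encode : ∀ {n} (v : Vec Bool n) → decode (encode v) ≡ v
decode-encode []          = refl
decode-encode (true  ∷ v) = cong (true ∷_) (decode-encode v)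
decode-encode (false ∷ v) = cong (false ∷_) (decode-encode v)

∣encode∣ : ∀ {n} (v : Vec Bool n) → ∣ encode v ∣ ≡ n * 2
∣encode∣ []          = refl
∣encode∣ (true  ∷ v) = cong (2 +_) (∣encode∣ v)
∣encode∣ (false ∷ v) = cong (2 +_) (∣encode∣ v)

weight-offset-assoc : ∀ {k} o j (S : Subset k) → weight (λ i → o + (j + toℕ i)) S ≡ weight (λ i → (o + j) + toℕ i) S
weight-offset-assoc o j = weight-cong (λ i → sym (+-assoc o j (toℕ i)))

weight-encode-∷ : ∀ {n} o a (v : Vec Bool n) →
  weight (λ i → o + toℕ i) (encode (a ∷ v)) ≡ (o + o + 3) + weight (λ i → (o + 4) + toℕ i) (encode v)
weight-encode-∷ o true  v = trans (cong (λ w → (o + 0) + ((o + 3) + w)) (weight-offset-assoc o 4 (encode v))) (block o _)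
  where
  block : ∀ o w → (o + 0) + ((o + 3) + w) ≡ (o + o + 3) + w
  block = solve-∀
weight-encode-∷ o false v = trans (cong (λ w → (o + 1) + ((o + 2) + w)) (weight-offset-assoc o 4 (encode v))) (block o _)
  where
  block : ∀ o w → (o + 1) + ((o + 2) + w) ≡ (o + o + 3) + w
  block = solve-∀

weight-encode-invariant : ∀ {n} o (u v : Vec Bool n) →
  weight (λ i → o + toℕ i) (encode u) ≡ weight (λ i → o + toℕ i) (encode v)
weight-encode-invariant o []      []      = refl
weight-encode-invariant o (a ∷ u) (b ∷ v) = begin
  weight (λ i → o + toℕ i) (encode (a ∷ u))                      ≡⟨ weight-encode-∷ o a u ⟩
  (o + o + 3) + weight (λ i → (o + 4) + toℕ i) (encode u)        ≡⟨ cong ((o + o + 3) +_) (weight-encode-invariant (o + 4) u v) ⟩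
  (o + o + 3) + weight (λ i → (o + 4) + toℕ i) (encode v)        ≡⟨ weight-encode-∷ o b v ⟨
  weight (λ i → o + toℕ i) (encode (b ∷ v))                      ∎
  where open ≡-Reasoning

decoy : ∀ {n} → Vec Bool n → Subset (suc n * 4)
decoy v = inside ∷ inside ∷ outside ∷ outside ∷ encode v

-- Definitionally the right-hand side is 2 + the left-hand side: the first block costs 0 + 3 there and 0 + 1 here.
weight-decoy≢ : ∀ {n} (v : Vec Bool n) → weight toℕ (decoy v) ≢ weight toℕ (encode (true ∷ v))
weight-decoy≢ v = <⇒≢ (m<n+m (weight toℕ (decoy v)) {2} z<s)

module HardInstance (m : ℕ) where

  n k h T : ℕ
  n = suc m
  k = n * 4
  h = n * 2
  c : Fin k → ℕ
  c = toℕ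
  T = weight c (encode (replicate n true))

  NoBad : Subset k → Set
  NoBad S = weight c S ≡ T

  YesBad : Vec Bool n → Subset k → Set
  YesBad v S = NoBad S × S ≢ encode v

  noBad? : Decidable NoBad
  noBad? S = weight c S ≟ T

  yesBad? : ∀ v → Decidable (YesBad v)
  yesBad? v S = noBad? S ×-dec ¬? (S ≟ᵥ encode v)

  module No = PavingMatroid {h = h} noBad?
  module Yes (v : Vec Bool n) = PavingMatroid {h = h} (yesBad? v)

  N : Subset k → Bool
  N = No.oracle

  M : Vec Bool n → Subset k → Bool
  M v = Yes.oracle v

  N-isMatroid : IsMatroid N
  N-isMatroid = No.isMatroid z<s (weight≡-sparse {c = c} toℕ-injective T)

  M-isMatroid : ∀ v → IsMatroid (M v)
  M-isMatroid v = Yes.isMatroid v z<s (Sparse-anti {Bad = NoBad} {YesBad v} proj₁ (weight≡-sparse {c = c} toℕ-injective T))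

  N-no : ¬ EMBYes k c T N
  N-no (S , basis , wS≡T) = No.basis⇒good {decoy v₀} {S} (cong (2 +_) (∣encode∣ v₀)) (weight-decoy≢ v₀) basis wS≡T
    where
    v₀ : Vec Bool m
    v₀ = replicate m true

  M-yes : ∀ v → EMBYes k c T (M v)
  M-yes v = encode v , Yes.good⇒basis v (∣encode∣ v) (λ bad → proj₂ bad refl) , weight-encode-invariant 0 v (replicate n true)

  N≢M⇒encode : ∀ v S → N S ≢ M v S → S ≡ encode v
  N≢M⇒encode v S NS≢MS = decidable-stable (S ≟ᵥ encode v)
    λ S≢v → NS≢MS (pavingOracle-cong h noBad? (yesBad? v) {S} (mk⇔ (_, S≢v) proj₁))

  instance-size≤8n^5 : suc k * (T + 2) * suc (weight c ⊤) ≤ (8 * n) ^ 5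
  instance-size≤8n^5 = instance-size≤ m {T} {weight c ⊤} (weight≤weight⊤ c (encode (replicate n true)))
                                         (weight⊤≤k*max c (λ i → <⇒≤ (toℕ<n i)))

SolvesEMBWithin : RandAlg → ℕ → Set
SolvesEMBWithin A d = ∀ (k : ℕ) (c : Fin k → ℕ) (T : ℕ) (𝓘 : Subset k → Bool) → IsMatroid 𝓘 →
                        Correct A k c T 𝓘 × TimeBound A d k c T 𝓘

fast-algorithm⇒2^n≤poly : ∀ A d m → SolvesEMBWithin A d → 2 ^ suc m ≤ 2 * (8 * suc m) ^ (5 * d)
fast-algorithm⇒2^n≤poly A d m H = ≤-trans queries-needed (*-monoʳ-≤ 2 Q≤poly)
  where
  open HardInstance m
  Q : ℕ
  Q = (suc k * (T + 2) * suc (weight c ⊤)) ^ d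
  Q≤poly : Q ≤ (8 * n) ^ (5 * d)
  Q≤poly = ≤-trans (^-monoˡ-≤ d instance-size≤8n^5) (≤-reflexive (^-*-assoc (8 * n) 5 d))
  queries-needed : 2 ^ n ≤ 2 * Q
  queries-needed = adversary-bound A c T N M encode decode decode-encode N≢M⇒encode rejects fast accepts
    where
    rejects : ∀ r → run (RandAlg.tree A k c T r) N ≡ false
    rejects = proj₂ (proj₁ (H k c T N N-isMatroid)) N-no
    fast : ∀ r → queries (RandAlg.tree A k c T r) N ≤ Q
    fast = proj₂ (H k c T N N-isMatroid)
    accepts : ∀ v → 2 ^ RandAlg.bits A k c T ≤ 2 * acceptCount A k c T (M v)
    accepts v = proj₁ (proj₁ (H k c T (M v) (M-isMatroid v))) (M-yes v)

theorem1p3 : (A : RandAlg) → (d : ℕ) →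
    ¬ (∀ (k : ℕ) (c : Fin k → ℕ) (T : ℕ) (𝓘 : Subset k → Bool) → IsMatroid 𝓘 →
         Correct A k c T 𝓘 × TimeBound A d k c T 𝓘)
theorem1p3 A d H =
  let m , 2*poly<2^n = 2^-beats-poly (5 * d)
  in  <⇒≱ 2*poly<2^n (fast-algorithm⇒2^n≤poly A d m H)
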